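{- Let $B$ be a multi-output ABP over noncommuting variables $y_1,\dots,y_n$ with $r$ sink nodes, the $i$-th sink computing $f_i\in\mathbb{F}\langle y_1,\dots,y_n\rangle$ for $i\in[r]$, and let $L_1,\dots,L_r$ be affine linear forms. One can construct an ABP of twice the size of $B$ that computes $\sum_{i=1}^r f_i\cdot L_i\cdot f_i^R$.
   Context: For a noncommutative polynomial $f=\sum_m [m]f\cdot m$ (sum over words $m$), its reverse is $f^R=\sum_m [m]f\cdot m^R$, where $m^R$ is the word $m$ written in reverse order. A multi-output ABP is a layered directed acyclic graph with one source and several sinks (in its last layer), edges only between consecutive layers, each labelled by a linear form; the polynomial at a sink is the sum over source-to-that-sink paths of the ordered (left-to-right along the path) product of edge labels. Size is the number of nodes/edges. -}

module Defs where

open import Level using (Level; _⊔_) renaming (suc to lsuc)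
open import Algebra.Bundles using (CommutativeRing)
open import Data.Nat using (ℕ; zero; suc) renaming (_+_ to _+ℕ_)
open import Data.Fin using (Fin; zero; suc)
open import Data.List using (List; []; _∷_; reverse)
open import Data.Product using (∃; _×_; _,_)
open import Relation.Nullary using (¬_)

record Field (c ℓ : Level) : Set (lsuc (c ⊔ ℓ)) where
  field
    commutativeRing : CommutativeRing c ℓ
  open CommutativeRing commutativeRing public
  field
    1≉0     : ¬ (1# ≈ 0#)
    inverse : ∀ x → ¬ (x ≈ 0#) → ∃ λ y → x * y ≈ 1#

module NCPoly {c ℓ : Level} (F : Field c ℓ) where
  open Field F using (Carrier; _≈_; _+_; _*_; 0#; 1#)

  Word : ℕ → Set
  Word n = List (Fin n)

  Poly : ℕ → Set c
  Poly n = Word n → Carrier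

  _≋_ : ∀ {n} → Poly n → Poly n → Set ℓ
  f ≋ g = ∀ m → f m ≈ g m

  zeroP : ∀ {n} → Poly n
  zeroP _ = 0#

  oneP : ∀ {n} → Poly n
  oneP []      = 1#
  oneP (_ ∷ _) = 0#

  _⊕_ : ∀ {n} → Poly n → Poly n → Poly n
  (f ⊕ g) m = f m + g m

  -- noncommutative product: [w](f·g) = Σ_{w = u v} [u]f · [v]g
  _⊗_ : ∀ {n} → Poly n → Poly n → Poly n
  (f ⊗ g) []      = f [] * g []
  (f ⊗ g) (a ∷ w) = f [] * g (a ∷ w) + ((λ u → f (a ∷ u)) ⊗ g) w

  ΣFin : ∀ {n} k → (Fin k → Poly n) → Poly n
  ΣFin zero    f = zeroP
  ΣFin (suc k) f = f zero ⊕ ΣFin k (λ i → f (suc i))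

  -- reverse: f^R = Σ_m [m]f · m^R, i.e. [m]f^R = [m^R]f
  rev : ∀ {n} → Poly n → Poly n
  rev f m = f (reverse m)

  record Affine (n : ℕ) : Set c where
    constructor affine
    field
      const : Carrier
      coeff : Fin n → Carrier

  affP : ∀ {n} → Affine n → Poly n
  affP (affine c₀ a) []          = c₀
  affP (affine c₀ a) (j ∷ [])    = a j
  affP (affine c₀ a) (_ ∷ _ ∷ _) = 0#

  -- Between consecutive layers of widths w, w' the edges are given by a
  -- w × w' matrix of affine forms (a zero label means "no edge").
  data Layers (n : ℕ) : ℕ → ℕ → Set c where
    done : ∀ {w} → Layers n w w
    step : ∀ {w w' r} → (Fin w → Fin w' → Affine n) → Layers n w' r → Layers n w r

  -- multi-output ABP: one source (first layer of width 1), r sinks = the last layer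
  ABP : ℕ → ℕ → Set c
  ABP n r = Layers n 1 r

  run : ∀ {n w r} → Layers n w r → (Fin w → Poly n) → (Fin r → Poly n)
  run done       v = v
  run {w = w} (step M rest) v = run rest (λ j → ΣFin w (λ i → v i ⊗ affP (M i j)))

  outputs : ∀ {n r} → ABP n r → Fin r → Poly n
  outputs B = run B (λ _ → oneP)

  sizeL : ∀ {n w r} → Layers n w r → ℕ
  sizeL {w = w} done          = w
  sizeL {w = w} (step _ rest) = w +ℕ sizeL rest

  size : ∀ {n r} → ABP n r → ℕ
  size = sizeL

-- The required program is the mirror of B: run B, multiply the value at sink i by L i in a
-- diagonal layer, then run B backwards (layers in reverse order, edge matrices transposed).
-- Let transfer l i j be the sum over paths from node i of the first layer to node j of the
-- last one. Reading a path backwards reverses the product of its labels; since the labels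
-- are affine this reduces to rev (ℓ · f) = rev f · ℓ, so the backward copy of B has transfer
-- matrix the transpose of rev ∘ transfer B. Every path of the mirror crosses the diagonal
-- layer at one edge i → i, whence the sum of f i · L i · rev (f i). The mirror consists of
-- B, a second copy of the sink layer of B and the remaining layers of B once more.

module Submission where

open import Defs
open import Data.Nat using (ℕ; _≤_; _*_)
open import Data.Fin using (Fin; zero)
open import Data.Product using (Σ; _×_)

open import Level using (Level)
open import Data.Nat using (suc)
import Data.Nat.Properties as ℕ
open import Data.Fin using (suc; _≟_; punchIn)
open import Data.Fin.Properties using (punchInᵢ≢i)
open import Data.Product using (_,_)
open import Algebra.Bundles using (Semiring)
open import Algebra.Structures using (IsSemiring)
import Algebra.Construct.Pointwise as Pointwise
import Algebra.Properties.CommutativeSemigroup as CommSemigroupProperties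
open import Data.List using ([]; _∷_; _∷ʳ_; reverse)
open import Data.List.Properties using (reverse-++)
open import Data.List.Reverse using (reverseView; []; _∶_∶ʳ_)
open import Function using (_∘_; flip)
open import Data.Bool using (if_then_else_)
open import Relation.Nullary using (does; yes; no)
open import Relation.Nullary.Decidable using (dec-true; dec-false)
open import Relation.Binary.PropositionalEquality using (_≢_)
import Relation.Binary.PropositionalEquality as ≡

module NCPolySemiring {c ℓ : Level} (F : Field c ℓ) where
  open Field F hiding (zero) renaming (_*_ to _·_)
  open NCPoly F
  open CommSemigroupProperties +-commutativeSemigroup using (interchange)
  open import Relation.Binary.Reasoning.Setoid setoid

  module _ {n : ℕ} where
    leftQuotient : Fin n → Poly n → Poly n
    leftQuotient a f u = f (a ∷ u)

    _*ₗ_ : Carrier → Poly n → Poly n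
    (k *ₗ f) m = k · f m

    ⊗-cong : {f f' g g' : Poly n} → f ≋ f' → g ≋ g' → (f ⊗ g) ≋ (f' ⊗ g')
    ⊗-cong f≋f' g≋g' []      = *-cong (f≋f' []) (g≋g' [])
    ⊗-cong f≋f' g≋g' (a ∷ w) =
      +-cong (*-cong (f≋f' []) (g≋g' (a ∷ w))) (⊗-cong (f≋f' ∘ (a ∷_)) g≋g' w)

    ⊗-distribˡ : ∀ (f g h : Poly n) → (f ⊗ (g ⊕ h)) ≋ ((f ⊗ g) ⊕ (f ⊗ h))
    ⊗-distribˡ f g h []      = distribˡ (f []) (g []) (h [])
    ⊗-distribˡ f g h (a ∷ w) = trans
      (+-cong (distribˡ (f []) (g (a ∷ w)) (h (a ∷ w))) (⊗-distribˡ (leftQuotient a f) g h w))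
      (interchange _ _ _ _)

    ⊗-distribʳ : ∀ (h f g : Poly n) → ((f ⊕ g) ⊗ h) ≋ ((f ⊗ h) ⊕ (g ⊗ h))
    ⊗-distribʳ h f g []      = distribʳ (h []) (f []) (g [])
    ⊗-distribʳ h f g (a ∷ w) = trans
      (+-cong (distribʳ (h (a ∷ w)) (f []) (g []))
              (⊗-distribʳ h (leftQuotient a f) (leftQuotient a g) w))
      (interchange _ _ _ _)

    ⊗-zeroˡ : ∀ (f : Poly n) → (zeroP ⊗ f) ≋ zeroP
    ⊗-zeroˡ f []      = zeroˡ (f [])
    ⊗-zeroˡ f (a ∷ w) = trans (+-cong (zeroˡ (f (a ∷ w))) (⊗-zeroˡ f w)) (+-identityˡ 0#)

    ⊗-zeroʳ : ∀ (f : Poly n) → (f ⊗ zeroP) ≋ zeroP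
    ⊗-zeroʳ f []      = zeroʳ (f [])
    ⊗-zeroʳ f (a ∷ w) = trans (+-cong (zeroʳ (f [])) (⊗-zeroʳ (leftQuotient a f) w)) (+-identityˡ 0#)

    ⊗-identityˡ : ∀ (f : Poly n) → (oneP ⊗ f) ≋ f
    ⊗-identityˡ f []      = *-identityˡ (f [])
    ⊗-identityˡ f (a ∷ w) = trans (+-cong (*-identityˡ (f (a ∷ w))) (⊗-zeroˡ f w)) (+-identityʳ _)

    ⊗-identityʳ : ∀ (f : Poly n) → (f ⊗ oneP) ≋ f
    ⊗-identityʳ f []      = *-identityʳ (f [])
    ⊗-identityʳ f (a ∷ w) = trans (+-cong (zeroʳ (f [])) (⊗-identityʳ (leftQuotient a f) w)) (+-identityˡ _)

    *ₗ-⊗ : ∀ k (f g : Poly n) → ((k *ₗ f) ⊗ g) ≋ (k *ₗ (f ⊗ g))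
    *ₗ-⊗ k f g []      = *-assoc k (f []) (g [])
    *ₗ-⊗ k f g (a ∷ w) = trans
      (+-cong (*-assoc k (f []) (g (a ∷ w))) (*ₗ-⊗ k (leftQuotient a f) g w))
      (sym (distribˡ k _ _))

    ⊗-assoc : ∀ (f g h : Poly n) → ((f ⊗ g) ⊗ h) ≋ (f ⊗ (g ⊗ h))
    ⊗-assoc f g h []      = *-assoc (f []) (g []) (h [])
    ⊗-assoc f g h (a ∷ w) = begin
      (x · y) · z + (((x *ₗ g′) ⊕ (f′ ⊗ g)) ⊗ h) w   ≈⟨ +-congˡ (⊗-distribʳ h (x *ₗ g′) (f′ ⊗ g) w) ⟩
      (x · y) · z + (((x *ₗ g′) ⊗ h) w + ((f′ ⊗ g) ⊗ h) w)
        ≈⟨ +-cong (*-assoc x y z) (+-cong (*ₗ-⊗ x g′ h w) (⊗-assoc f′ g h w)) ⟩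
      x · (y · z) + (x · (g′ ⊗ h) w + (f′ ⊗ (g ⊗ h)) w)   ≈⟨ sym (+-assoc _ _ _) ⟩
      (x · (y · z) + x · (g′ ⊗ h) w) + (f′ ⊗ (g ⊗ h)) w   ≈⟨ +-congʳ (sym (distribˡ x _ _)) ⟩
      x · (y · z + (g′ ⊗ h) w) + (f′ ⊗ (g ⊗ h)) w         ∎
      where
        x = f []
        y = g []
        z = h (a ∷ w)
        f′ = leftQuotient a f
        g′ = leftQuotient a g

    ncIsSemiring : IsSemiring (_≋_ {n}) _⊕_ _⊗_ zeroP oneP
    ncIsSemiring = record
      { isSemiringWithoutAnnihilatingZero = record
        { +-isCommutativeMonoid = Pointwise.isCommutativeMonoid (Word n) +-isCommutativeMonoid
        ; *-cong                = ⊗-cong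
        ; *-assoc               = ⊗-assoc
        ; *-identity            = ⊗-identityˡ , ⊗-identityʳ
        ; distrib               = ⊗-distribˡ , ⊗-distribʳ
        }
      ; zero = ⊗-zeroˡ , ⊗-zeroʳ
      }

    rev-cong : {f g : Poly n} → f ≋ g → rev f ≋ rev g
    rev-cong f≋g = f≋g ∘ reverse

    oneP-∷ʳ : ∀ (w : Word n) x → oneP (w ∷ʳ x) ≡.≡ 0#
    oneP-∷ʳ []      x = ≡.refl
    oneP-∷ʳ (_ ∷ _) x = ≡.refl

    rev-oneP : rev (oneP {n}) ≋ oneP
    rev-oneP m with reverseView m
    ... | []         = refl
    ... | w ∶ _ ∶ʳ x = reflexive (≡.trans (≡.cong oneP (reverse-++ w (x ∷ []))) (≡.sym (oneP-∷ʳ w x)))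

    zeroAffine : Affine n
    zeroAffine = affine 0# (λ _ → 0#)

    affP-zeroAffine : affP zeroAffine ≋ zeroP
    affP-zeroAffine []          = refl
    affP-zeroAffine (_ ∷ [])    = refl
    affP-zeroAffine (_ ∷ _ ∷ _) = refl

    affP-∷-∷ʳ : ∀ (A : Affine n) y w x → affP A (y ∷ (w ∷ʳ x)) ≡.≡ 0#
    affP-∷-∷ʳ A y []      x = ≡.refl
    affP-∷-∷ʳ A y (_ ∷ _) x = ≡.refl

    affP-⊗-∷ : ∀ c₀ a (f : Poly n) x w → (affP (affine c₀ a) ⊗ f) (x ∷ w) ≈ c₀ · f (x ∷ w) + a x · f w
    affP-⊗-∷ c₀ a f x w = +-congˡ (begin
      (leftQuotient x (affP (affine c₀ a)) ⊗ f) w ≈⟨ ⊗-cong quotient≋scalar (λ _ → refl) w ⟩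
      ((a x *ₗ oneP) ⊗ f) w                        ≈⟨ *ₗ-⊗ (a x) oneP f w ⟩
      a x · (oneP ⊗ f) w                           ≈⟨ *-congˡ (⊗-identityˡ f w) ⟩
      a x · f w                                    ∎)
      where
        quotient≋scalar : leftQuotient x (affP (affine c₀ a)) ≋ (a x *ₗ oneP)
        quotient≋scalar []      = sym (*-identityʳ _)
        quotient≋scalar (_ ∷ _) = sym (zeroʳ _)

    ⊗-affP-∷ʳ : ∀ c₀ a (f : Poly n) w x → (f ⊗ affP (affine c₀ a)) (w ∷ʳ x) ≈ f (w ∷ʳ x) · c₀ + f w · a x
    ⊗-affP-∷ʳ c₀ a f []      x = +-comm _ _
    ⊗-affP-∷ʳ c₀ a f (y ∷ w) x = begin
      f [] · affP (affine c₀ a) (y ∷ (w ∷ʳ x)) + (leftQuotient y f ⊗ affP (affine c₀ a)) (w ∷ʳ x)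
        ≈⟨ +-cong (trans (*-congˡ (reflexive (affP-∷-∷ʳ (affine c₀ a) y w x))) (zeroʳ _))
                  (⊗-affP-∷ʳ c₀ a (leftQuotient y f) w x) ⟩
      0# + (f (y ∷ (w ∷ʳ x)) · c₀ + f (y ∷ w) · a x)   ≈⟨ +-identityˡ _ ⟩
      f (y ∷ (w ∷ʳ x)) · c₀ + f (y ∷ w) · a x           ∎

    rev-affP-⊗ : ∀ (A : Affine n) (f : Poly n) → rev (affP A ⊗ f) ≋ (rev f ⊗ affP A)
    rev-affP-⊗ (affine c₀ a) f m with reverseView m
    ... | []         = *-comm _ _
    ... | w ∶ _ ∶ʳ x = begin
      (affP (affine c₀ a) ⊗ f) (reverse (w ∷ʳ x))     ≡⟨ ≡.cong (affP (affine c₀ a) ⊗ f) reverse-∷ʳ ⟩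
      (affP (affine c₀ a) ⊗ f) (x ∷ reverse w)        ≈⟨ affP-⊗-∷ c₀ a f x (reverse w) ⟩
      c₀ · f (x ∷ reverse w) + a x · f (reverse w)
        ≡⟨ ≡.cong (λ u → c₀ · f u + a x · f (reverse w)) reverse-∷ʳ ⟨
      c₀ · rev f (w ∷ʳ x) + a x · rev f w              ≈⟨ +-cong (*-comm _ _) (*-comm _ _) ⟩
      rev f (w ∷ʳ x) · c₀ + rev f w · a x              ≈⟨ ⊗-affP-∷ʳ c₀ a (rev f) w x ⟨
      (rev f ⊗ affP (affine c₀ a)) (w ∷ʳ x)           ∎
      where
        reverse-∷ʳ : reverse (w ∷ʳ x) ≡.≡ x ∷ reverse w
        reverse-∷ʳ = reverse-++ w (x ∷ [])

  ncSemiring : ℕ → Semiring c ℓ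
  ncSemiring n = record { isSemiring = ncIsSemiring {n} }

module KroneckerDelta {c ℓ : Level} (R : Semiring c ℓ) where
  open Semiring R hiding (zero) renaming (_*_ to _·_)
  open import Algebra.Properties.Semiring.Sum R
    using (sum; sum-remove; sum-cong-≋; sum-replicate-zero)
  open import Relation.Binary.Reasoning.Setoid setoid

  δ : ∀ {k} → Fin k → Fin k → Carrier
  δ i j = if does (i ≟ j) then 1# else 0#

  δ-diag : ∀ {k} (i : Fin k) → δ i i ≡.≡ 1#
  δ-diag i rewrite dec-true (i ≟ i) ≡.refl = ≡.refl

  δ-off : ∀ {k} {i j : Fin k} → i ≢ j → δ i j ≡.≡ 0#
  δ-off {i = i} {j} i≢j rewrite dec-false (i ≟ j) i≢j = ≡.refl

  δ-sym : ∀ {k} (i j : Fin k) → δ i j ≡.≡ δ j i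
  δ-sym i j with i ≟ j
  ... | yes ≡.refl = ≡.sym (δ-diag i)
  ... | no i≢j     = ≡.sym (δ-off (i≢j ∘ ≡.sym))

  δ-preserved : ∀ (φ : Carrier → Carrier) → φ 0# ≈ 0# → φ 1# ≈ 1# →
                ∀ {k} (i j : Fin k) → φ (δ i j) ≈ δ i j
  δ-preserved φ φ0 φ1 i j with i ≟ j
  ... | yes _ = φ1
  ... | no _  = φ0

  sum-single : ∀ {k} (t : Fin k → Carrier) i → (∀ j → j ≢ i → t j ≈ 0#) → sum t ≈ t i
  sum-single {suc k} t i t≈0 = begin
    sum t                      ≈⟨ sum-remove t ⟩
    t i + sum (t ∘ punchIn i)  ≈⟨ +-congˡ (sum-cong-≋ {k} (λ j → t≈0 (punchIn i j) (punchInᵢ≢i i j))) ⟩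
    t i + sum {k} (λ _ → 0#)   ≈⟨ +-congˡ (sum-replicate-zero k) ⟩
    t i + 0#                   ≈⟨ +-identityʳ (t i) ⟩
    t i                        ∎

  ∑-δˡ : ∀ {k} (i : Fin k) (t : Fin k → Carrier) → sum (λ j → δ i j · t j) ≈ t i
  ∑-δˡ i t = trans
    (sum-single _ i (λ j j≢i → trans (*-congʳ (reflexive (δ-off (j≢i ∘ ≡.sym)))) (zeroˡ (t j))))
    (trans (*-congʳ (reflexive (δ-diag i))) (*-identityˡ (t i)))

  ∑-δʳ : ∀ {k} (i : Fin k) (t : Fin k → Carrier) → sum (λ j → t j · δ j i) ≈ t i
  ∑-δʳ i t = trans
    (sum-single _ i (λ j j≢i → trans (*-congˡ (reflexive (δ-off j≢i))) (zeroʳ (t j))))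
    (trans (*-congˡ (reflexive (δ-diag i))) (*-identityʳ (t i)))

module LayerOperations {c ℓ : Level} (F : Field c ℓ) {n : ℕ} where
  open NCPoly F using (Affine; Layers; done; step; run; ABP; sizeL; size)
  open NCPolySemiring F using (zeroAffine)
  open import Data.Nat using (_+_)
  open ≡.≡-Reasoning

  _++_ : ∀ {a b d} → Layers n a b → Layers n b d → Layers n a d
  done        ++ l = l
  step M rest ++ l = step M (rest ++ l)

  reverseLayers : ∀ {w r} → Layers n w r → Layers n r w
  reverseLayers done          = done
  reverseLayers (step M rest) = reverseLayers rest ++ step (flip M) done

  diagonal : ∀ {r} → (Fin r → Affine n) → Fin r → Fin r → Affine n
  diagonal L i j = if does (i ≟ j) then L i else zeroAffine

  mirror : ∀ {r} → ABP n r → (Fin r → Affine n) → ABP n 1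
  mirror B L = B ++ step (diagonal L) (reverseLayers B)

  run-++ : ∀ {a b d} (l₁ : Layers n a b) (l₂ : Layers n b d) v →
           run (l₁ ++ l₂) v ≡.≡ run l₂ (run l₁ v)
  run-++ done          l₂ v = ≡.refl
  run-++ (step M rest) l₂ v = run-++ rest l₂ _

  size-++ : ∀ {a b d} (l₁ : Layers n a b) (l₂ : Layers n b d) →
            sizeL (l₁ ++ l₂) + b ≡.≡ sizeL l₁ + sizeL l₂
  size-++ {b = b} done l₂ = ℕ.+-comm (sizeL l₂) b
  size-++ {a} {b} (step M rest) l₂ = begin
    a + sizeL (rest ++ l₂) + b     ≡⟨ ℕ.+-assoc a _ b ⟩
    a + (sizeL (rest ++ l₂) + b)   ≡⟨ ≡.cong (a +_) (size-++ rest l₂) ⟩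
    a + (sizeL rest + sizeL l₂)    ≡⟨ ℕ.+-assoc a _ _ ⟨
    a + sizeL rest + sizeL l₂      ∎

  size-reverse : ∀ {w r} (l : Layers n w r) → sizeL (reverseLayers l) ≡.≡ sizeL l
  size-reverse done = ≡.refl
  size-reverse {w} (step {w' = w'} M rest) = ℕ.+-cancelʳ-≡ w' _ _ (begin
    sizeL (reverseLayers rest ++ step (flip M) done) + w'  ≡⟨ size-++ (reverseLayers rest) _ ⟩
    sizeL (reverseLayers rest) + (w' + w)
      ≡⟨ ≡.cong₂ _+_ (size-reverse rest) (ℕ.+-comm w' w) ⟩
    sizeL rest + (w + w')                                  ≡⟨ ℕ.+-assoc (sizeL rest) w w' ⟨
    sizeL rest + w + w'                                    ≡⟨ ≡.cong (_+ w') (ℕ.+-comm (sizeL rest) w) ⟩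
    w + sizeL rest + w'                                    ∎)

  size-mirror : ∀ {r} (B : ABP n r) (L : Fin r → Affine n) → size (mirror B L) ≡.≡ 2 * size B
  size-mirror {r} B L = ℕ.+-cancelʳ-≡ r _ _ (begin
    sizeL (mirror B L) + r                   ≡⟨ size-++ B _ ⟩
    sizeL B + (r + sizeL (reverseLayers B))  ≡⟨ ≡.cong (λ s → sizeL B + (r + s)) (size-reverse B) ⟩
    sizeL B + (r + sizeL B)                  ≡⟨ ≡.cong (sizeL B +_) (ℕ.+-comm r (sizeL B)) ⟩
    sizeL B + (sizeL B + r)                  ≡⟨ ℕ.+-assoc (sizeL B) (sizeL B) r ⟨
    sizeL B + sizeL B + r                    ≡⟨ ≡.cong (λ s → sizeL B + s + r) (ℕ.+-identityʳ (sizeL B)) ⟨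
    2 * sizeL B + r                          ∎)

module Transfer {c ℓ : Level} (F : Field c ℓ) {n : ℕ} where
  open NCPoly F
  open NCPolySemiring F using (ncSemiring; rev-cong; rev-oneP; affP-zeroAffine; rev-affP-⊗)
  open LayerOperations F
  open Semiring (ncSemiring n)
    using ( setoid; refl; sym; trans; reflexive; +-congˡ; +-identityʳ
          ; *-cong; *-congˡ; *-congʳ; *-assoc; *-identityˡ; zeroʳ)
  open import Algebra.Properties.Semiring.Sum (ncSemiring n)
    using (sum; sum-syntax; sum-cong-≋; ∑-comm; *-distribˡ-sum; *-distribʳ-sum)
  open KroneckerDelta (ncSemiring n) using (δ; δ-sym; δ-preserved; sum-single; ∑-δˡ; ∑-δʳ)
  open import Relation.Binary.Reasoning.Setoid setoid

  ΣFin≋sum : ∀ k (h : Fin k → Poly n) → ΣFin k h ≋ sum h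
  ΣFin≋sum 0       h = refl
  ΣFin≋sum (suc k) h = +-congˡ (ΣFin≋sum k (h ∘ suc))

  rev-sum : ∀ {k} (h : Fin k → Poly n) → rev (sum h) ≋ sum (rev ∘ h)
  rev-sum {0}     h = refl
  rev-sum {suc k} h = +-congˡ (rev-sum (h ∘ suc))

  transfer : ∀ {w r} → Layers n w r → Fin w → Fin r → Poly n
  transfer done          = δ
  transfer (step {w' = w'} M rest) i j = ∑[ k < w' ] (affP (M i k) ⊗ transfer rest k j)

  run≋transfer : ∀ {w r} (l : Layers n w r) v j → run l v j ≋ (∑[ i < w ] (v i ⊗ transfer l i j))
  run≋transfer done v j = sym (∑-δʳ j v)
  run≋transfer {w} (step {w' = w'} M rest) v j = begin
    run rest u j
      ≈⟨ run≋transfer rest u j ⟩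
    ∑[ k < w' ] (u k ⊗ T k)
      ≈⟨ sum-cong-≋ (λ k → *-congʳ (ΣFin≋sum w (λ i → v i ⊗ a i k))) ⟩
    ∑[ k < w' ] ((∑[ i < w ] (v i ⊗ a i k)) ⊗ T k)
      ≈⟨ sum-cong-≋ (λ k → *-distribʳ-sum (T k) (λ i → v i ⊗ a i k)) ⟩
    ∑[ k < w' ] ∑[ i < w ] ((v i ⊗ a i k) ⊗ T k)
      ≈⟨ ∑-comm (λ k i → (v i ⊗ a i k) ⊗ T k) ⟩
    ∑[ i < w ] ∑[ k < w' ] ((v i ⊗ a i k) ⊗ T k)
      ≈⟨ sum-cong-≋ (λ i → sum-cong-≋ (λ k → *-assoc (v i) (a i k) (T k))) ⟩
    ∑[ i < w ] ∑[ k < w' ] (v i ⊗ (a i k ⊗ T k))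
      ≈⟨ sum-cong-≋ (λ i → *-distribˡ-sum (v i) (λ k → a i k ⊗ T k)) ⟨
    ∑[ i < w ] (v i ⊗ transfer (step M rest) i j)
      ∎
    where
      a : Fin w → Fin w' → Poly n
      a i k = affP (M i k)
      T : Fin w' → Poly n
      T k = transfer rest k j
      u : Fin w' → Poly n
      u k = ΣFin w (λ i → v i ⊗ a i k)

  transfer≋run-δ : ∀ {w r} (l : Layers n w r) i j → transfer l i j ≋ run l (δ i) j
  transfer≋run-δ l i j = sym (trans (run≋transfer l (δ i) j) (∑-δˡ i (λ i′ → transfer l i′ j)))

  transfer-++ : ∀ {a b d} (l₁ : Layers n a b) (l₂ : Layers n b d) i k →
    transfer (l₁ ++ l₂) i k ≋ (∑[ j < b ] (transfer l₁ i j ⊗ transfer l₂ j k))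
  transfer-++ {b = b} l₁ l₂ i k = begin
    transfer (l₁ ++ l₂) i k                         ≈⟨ transfer≋run-δ (l₁ ++ l₂) i k ⟩
    run (l₁ ++ l₂) (δ i) k                          ≡⟨ ≡.cong (λ v → v k) (run-++ l₁ l₂ (δ i)) ⟩
    run l₂ (run l₁ (δ i)) k                         ≈⟨ run≋transfer l₂ _ k ⟩
    ∑[ j < b ] (run l₁ (δ i) j ⊗ transfer l₂ j k)
      ≈⟨ sum-cong-≋ (λ j → *-congʳ (transfer≋run-δ l₁ i j)) ⟨
    ∑[ j < b ] (transfer l₁ i j ⊗ transfer l₂ j k)  ∎

  transfer-reverse : ∀ {w r} (l : Layers n w r) i j →
                     transfer (reverseLayers l) j i ≋ rev (transfer l i j)
  transfer-reverse done i j =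
    trans (reflexive (δ-sym j i)) (sym (δ-preserved rev (λ _ → Field.refl F) rev-oneP i j))
  transfer-reverse (step {w' = w'} M rest) i j = begin
    transfer (reverseLayers rest ++ step (flip M) done) j i
      ≈⟨ transfer-++ (reverseLayers rest) (step (flip M) done) j i ⟩
    ∑[ k < w' ] (transfer (reverseLayers rest) j k ⊗ transfer (step (flip M) done) k i)
      ≈⟨ sum-cong-≋ (λ k → *-cong (transfer-reverse rest k j) (∑-δʳ i (λ i′ → affP (M i′ k)))) ⟩
    ∑[ k < w' ] (rev (transfer rest k j) ⊗ affP (M i k))
      ≈⟨ sum-cong-≋ (λ k → rev-affP-⊗ (M i k) (transfer rest k j)) ⟨
    ∑[ k < w' ] rev (affP (M i k) ⊗ transfer rest k j)
      ≈⟨ rev-sum (λ k → affP (M i k) ⊗ transfer rest k j) ⟨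
    rev (transfer (step M rest) i j) ∎

  outputs≋transfer : ∀ {r} (B : ABP n r) j → outputs B j ≋ transfer B zero j
  outputs≋transfer B j = trans (run≋transfer B _ j) (trans (+-identityʳ _) (*-identityˡ _))

  ∑-diagonal : ∀ {r} (L : Fin r → Affine n) (v : Fin r → Poly n) j →
    (∑[ i < r ] (v i ⊗ affP (diagonal L i j))) ≋ (v j ⊗ affP (L j))
  ∑-diagonal L v j = trans (sum-single _ j off-diagonal) on-diagonal
    where
      off-diagonal : ∀ i → i ≢ j → (v i ⊗ affP (diagonal L i j)) ≋ zeroP
      off-diagonal i i≢j rewrite dec-false (i ≟ j) i≢j = trans (*-congˡ affP-zeroAffine) (zeroʳ (v i))
      on-diagonal : (v j ⊗ affP (diagonal L j j)) ≋ (v j ⊗ affP (L j))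
      on-diagonal rewrite dec-true (j ≟ j) ≡.refl = refl

  outputs-mirror : ∀ {r} (B : ABP n r) (L : Fin r → Affine n) →
    outputs (mirror B L) zero ≋ ΣFin r (λ j → (outputs B j ⊗ affP (L j)) ⊗ rev (outputs B j))
  outputs-mirror {r} B L = begin
    outputs (mirror B L) zero
      ≡⟨ ≡.cong (λ v → v zero) (run-++ B _ (λ _ → oneP)) ⟩
    run (reverseLayers B) u zero
      ≈⟨ run≋transfer (reverseLayers B) u zero ⟩
    ∑[ j < r ] (u j ⊗ transfer (reverseLayers B) j zero)
      ≈⟨ sum-cong-≋ (λ j → *-cong (scaled j) (transfer-reverse B zero j)) ⟩
    ∑[ j < r ] ((f j ⊗ affP (L j)) ⊗ rev (transfer B zero j))
      ≈⟨ sum-cong-≋ (λ j → *-congˡ (rev-cong (outputs≋transfer B j))) ⟨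
    ∑[ j < r ] ((f j ⊗ affP (L j)) ⊗ rev (f j))
      ≈⟨ ΣFin≋sum r (λ j → (f j ⊗ affP (L j)) ⊗ rev (f j)) ⟨
    ΣFin r (λ j → (f j ⊗ affP (L j)) ⊗ rev (f j))
      ∎
    where
      f : Fin r → Poly n
      f = outputs B
      u : Fin r → Poly n
      u j = ΣFin r (λ i → f i ⊗ affP (diagonal L i j))
      scaled : ∀ j → u j ≋ (f j ⊗ affP (L j))
      scaled j = trans (ΣFin≋sum r (λ i → f i ⊗ affP (diagonal L i j))) (∑-diagonal L f j)

lemma5 : ∀ {c ℓ} (F : Field c ℓ) → let open NCPoly F in
    ∀ {n r : ℕ} (B : ABP n r) (L : Fin r → Affine n) →
    Σ (ABP n 1) λ C →
      (size C ≤ 2 * size B)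
      × (outputs C zero ≋ ΣFin r (λ i → (outputs B i ⊗ affP (L i)) ⊗ rev (outputs B i)))
lemma5 F B L = mirror B L , ℕ.≤-reflexive (size-mirror B L) , outputs-mirror B L
  where
    open LayerOperations F
    open Transfer F
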